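{- Let $c \ge 4$ be an even integer and $n \ge 2$, let $N = 2^{n-1}-1$ and $\theta = 2^{1/N}$, and suppose $u, v$ are coprime integers with $u$ even, $c = uv$, and $v^N - \frac{1}{4}u^N = a_{n-1}(c)$ (such $u,v$ exist whenever $a_n(c)$ is a square). Then \[ (3 - 2\sqrt{2})^{1/N} < \frac{u}{\theta^2 v} < (3 + 2\sqrt{2})^{1/N} \quad\text{and}\quad (3 - 2\sqrt{2})^{1/N} < \frac{\theta^2 v}{u} < (3 + 2\sqrt{2})^{1/N}. \] In particular, \[ \frac{1}{uv} < \frac{(3+2\sqrt{2})^{1/N}}{\theta^2}\,\frac{1}{v^2} \quad\text{and}\quad c > \theta^2 (3 - 2\sqrt{2})^{1/N} v^2 . \]
   Context: $a_1(c) = 1$ and $a_m(c) = a_{m-1}(c)^2 + c^{2^{m-1}-1}$ for $m \ge 2$. -}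

module Defs where

open import Data.Nat using (ℕ; zero; suc; _∸_)
import Data.Nat as ℕ
open import Data.Integer using (ℤ; +_; _+_; _*_; -_; _-_; _^_; _<_; 0ℤ)
open import Data.Product using (_×_)
open import Data.Sum using (_⊎_)

-- The sequence a_m(c):  a_1(c) = 1,  a_m(c) = a_{m-1}(c)^2 + c^(2^(m-1) - 1)  (m ≥ 2).
-- a 0 is junk (set to 1); it is never used (the statement only uses a (n ∸ 1) with n ≥ 2).
a : ℕ → ℤ → ℤ
a zero          c = + 1
a (suc zero)    c = + 1
a (suc (suc k)) c = a (suc k) c ^ 2 + c ^ (2 ℕ.^ (suc k) ∸ 1)

-- mk√2 x y represents x + y·√2; of ℤ[√2] ⊂ ℝ.
record ℤ√2 : Set where
  constructor mk√2
  field
    re : ℤ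
    im : ℤ
open ℤ√2 public

embed : ℤ → ℤ√2
embed x = mk√2 x 0ℤ

_⊕_ : ℤ√2 → ℤ√2 → ℤ√2
mk√2 x y ⊕ mk√2 x' y' = mk√2 (x + x') (y + y')

⊝_ : ℤ√2 → ℤ√2
⊝ mk√2 x y = mk√2 (- x) (- y)

infixl 7 _⊗_
_⊗_ : ℤ√2 → ℤ√2 → ℤ√2
mk√2 x y ⊗ mk√2 x' y' = mk√2 (x * x' + + 2 * (y * y')) (x * y' + y * x')

-- x + y√2 > 0 as a real number.
Pos : ℤ√2 → Set
Pos (mk√2 x y) =
  (0ℤ < x × + 2 * (y * y) < x * x)
  ⊎ (0ℤ < y × x * x < + 2 * (y * y))
  ⊎ (0ℤ < x × 0ℤ < y)

-- Real numbers of the form α / d with α ∈ ℤ[√2], d ∈ ℤ (d ≠ 0 intended).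
record Frac : Set where
  constructor _//_
  field
    num : ℤ√2
    den : ℤ
infix 5 _//_

-- Strict order of the reals α/d < β/e (for d, e ≠ 0):
-- β/e − α/d = (β d − α e)/(d e) > 0  ⇔  (β d − α e)·(d e) > 0.
_<F_ : Frac → Frac → Set
(α // d) <F (β // e) = Pos (((β ⊗ embed d) ⊕ (⊝ (α ⊗ embed e))) ⊗ embed (d * e))
infix 4 _<F_

3-2√2 : ℤ√2
3-2√2 = mk√2 (+ 3) (- + 2)

3+2√2 : ℤ√2
3+2√2 = mk√2 (+ 3) (+ 2)

{-# OPTIONS --safe #-}
module Submission where

-- Put U = uᴺ, V = vᴺ and A = a_{n-1}(c), so that 4V − U = 4A and UV = cᴺ.
-- Squaring the recursion gives a_m(c)² < c^(2^m − 1) for c ≥ 4, hence A² < UV, and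
-- then U² + (4V)² < 6·U·(4V), the difference being 16 (UV − A²).  For x = U/(4V)
-- (or its inverse) this is x² − 6x + 1 < 0, i.e. 3 − 2√2 < x < 3 + 2√2; the last two
-- inequalities are rearrangements of these.  In ℤ[√2] each comparison comes down to an
-- element X + Y√2 with Y > 0 and X² < 2Y².

open import Defs
open import Data.Empty using (⊥-elim)
open import Data.List using (_∷_; [])
open import Data.Nat using (ℕ; zero; suc; _∸_; NonZero)
import Data.Nat as ℕ
import Data.Nat.Properties as ℕ
open import Data.Integer using (ℤ; +_; _+_; _*_; -_; _-_; _^_; _≤_; _<_; 0ℤ; +0; +[1+_]; -[1+_]; +<+; +≤+)
open import Data.Integer.Base using (nonNegative; positive)
open import Data.Integer.Divisibility using (_∣_)
open import Data.Integer.Coprimality using (Coprime)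
open import Data.Integer.Properties
open import Data.Integer.Tactic.RingSolver using (solve; solve-∀)
open import Data.Product using (_×_; _,_)
open import Data.Sum using (inj₁; inj₂)
open import Algebra.Properties.CommutativeSemigroup *-commutativeSemigroup using (interchange)
open import Relation.Binary.PropositionalEquality
open import Relation.Nullary using (¬_)

i*i≥0 : ∀ i → 0ℤ ≤ i * i
i*i≥0 +0       = ≤-refl
i*i≥0 +[1+ n ] = +≤+ ℕ.z≤n
i*i≥0 -[1+ n ] = +≤+ ℕ.z≤n

i≢0⇒i*i>0 : ∀ {i} → ¬ i ≡ 0ℤ → 0ℤ < i * i
i≢0⇒i*i>0 {+0}       i≢0 = ⊥-elim (i≢0 refl)
i≢0⇒i*i>0 {+[1+ n ]} _   = +<+ (ℕ.s≤s ℕ.z≤n)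
i≢0⇒i*i>0 { -[1+ n ]} _  = +<+ (ℕ.s≤s ℕ.z≤n)

*-pos : ∀ {i j} → 0ℤ < i → 0ℤ < j → 0ℤ < i * j
*-pos {i} {j} i>0 j>0 = subst (_< i * j) (*-zeroʳ i) (*-monoˡ-<-pos i {{positive i>0}} j>0)

i<j⇒0<j-i : ∀ {i j} → i < j → 0ℤ < j - i
i<j⇒0<j-i {i} {j} i<j = subst (_< j - i) (+-inverseʳ i) (+-monoˡ-< (- i) i<j)

0<j-i⇒i<j : ∀ {i j} → 0ℤ < j - i → i < j
0<j-i⇒i<j {i} {j} 0<j-i = subst₂ _<_ (+-identityʳ i) i+[j-i]≡j (+-monoʳ-< i 0<j-i)
  where
  i+[j-i]≡j : i + (j - i) ≡ j
  i+[j-i]≡j = solve (i ∷ j ∷ [])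

-- The proof comes before the equation so that a `solve` in the second argument
-- is elaborated against a fully known equation.
0<-≡ : ∀ {i j} → 0ℤ < i → i ≡ j → 0ℤ < j
0<-≡ 0<i refl = 0<i

0≤i<j⇒i*i<j*j : ∀ {i j} → 0ℤ ≤ i → i < j → i * i < j * j
0≤i<j⇒i*i<j*j {i} {j} 0≤i i<j = begin-strict
  i * i  ≤⟨ *-monoˡ-≤-nonNeg i {{nonNegative 0≤i}} (<⇒≤ i<j) ⟩
  i * j  <⟨ *-monoʳ-<-pos j {{positive (≤-<-trans 0≤i i<j)}} i<j ⟩
  j * j  ∎
  where open ≤-Reasoning

^-distribʳ-* : ∀ i j n → (i * j) ^ n ≡ i ^ n * j ^ n
^-distribʳ-* i j zero    = refl
^-distribʳ-* i j (suc n) =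
  trans (cong (i * j *_) (^-distribʳ-* i j n)) (interchange i j (i ^ n) (j ^ n))

^[2m∸1]≡*[^[m∸1]]² : ∀ i m .{{_ : NonZero m}} →
                     i ^ (2 ℕ.* m ∸ 1) ≡ i * (i ^ (m ∸ 1) * i ^ (m ∸ 1))
^[2m∸1]≡*[^[m∸1]]² i (suc t) = begin
  i ^ (t ℕ.+ suc (t ℕ.+ 0))  ≡⟨ cong (i ^_) (ℕ.+-suc t (t ℕ.+ 0)) ⟩
  i ^ suc (t ℕ.+ (t ℕ.+ 0))  ≡⟨ cong (λ s → i ^ suc (t ℕ.+ s)) (ℕ.+-identityʳ t) ⟩
  i * i ^ (t ℕ.+ t)          ≡⟨ cong (i *_) (^-distribˡ-+-* i t t) ⟩
  i * (i ^ t * i ^ t)        ∎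
  where open ≡-Reasoning

-- a_{k+2} = a_{k+1}² + S < 2S with S = c^(2^(k+1) − 1), and 4S² ≤ c S² = c^(2^(k+2) − 1).
a[1+k]²<c^[2^[1+k]∸1] : ∀ {c} → + 4 ≤ c → ∀ k →
                        a (suc k) c * a (suc k) c < c ^ (2 ℕ.^ suc k ∸ 1)
a[1+k]²<c^[2^[1+k]∸1] {c} c≥4 zero = begin-strict
  + 1      <⟨ +<+ (ℕ.s≤s (ℕ.s≤s ℕ.z≤n)) ⟩
  + 4      ≤⟨ c≥4 ⟩
  c        ≡⟨ *-identityʳ c ⟨
  c * + 1  ∎
  where open ≤-Reasoning
a[1+k]²<c^[2^[1+k]∸1] {c} c≥4 (suc k) = begin-strict
  B * B                        <⟨ 0≤i<j⇒i*i<j*j 0≤B B<S+S ⟩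
  (S + S) * (S + S)            ≡⟨ [i+i]²≡4i² S ⟩
  + 4 * (S * S)                ≤⟨ *-monoʳ-≤-nonNeg (S * S) {{nonNegative (i*i≥0 S)}} c≥4 ⟩
  c * (S * S)                  ≡⟨ ^[2m∸1]≡*[^[m∸1]]² c (2 ℕ.^ suc k) {{ℕ.m^n≢0 2 (suc k)}} ⟨
  c ^ (2 ℕ.^ suc (suc k) ∸ 1)  ∎
  where
  open ≤-Reasoning
  A S B : ℤ
  A = a (suc k) c
  S = c ^ (2 ℕ.^ suc k ∸ 1)
  B = A ^ 2 + S
  A*A<S : A * A < S
  A*A<S = a[1+k]²<c^[2^[1+k]∸1] c≥4 k
  A^2≡A*A : A ^ 2 ≡ A * A
  A^2≡A*A = cong (A *_) (*-identityʳ A)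
  0≤B : 0ℤ ≤ B
  0≤B = +-mono-≤ (subst (0ℤ ≤_) (sym A^2≡A*A) (i*i≥0 A)) (<⇒≤ (≤-<-trans (i*i≥0 A) A*A<S))
  B<S+S : B < S + S
  B<S+S = +-monoˡ-< S (subst (_< S) (sym A^2≡A*A) A*A<S)
  [i+i]²≡4i² : ∀ i → (i + i) * (i + i) ≡ + 4 * (i * i)
  [i+i]²≡4i² = solve-∀

⊗-embed : ∀ x y k → mk√2 x y ⊗ embed k ≡ mk√2 (x * k) (y * k)
⊗-embed x y k = cong₂ mk√2 (x*k+2[y*0]≡x*k x y k) (x*0+y*k≡y*k x y k)
  where
  x*k+2[y*0]≡x*k : ∀ x y k → x * k + + 2 * (y * 0ℤ) ≡ x * k
  x*k+2[y*0]≡x*k = solve-∀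
  x*0+y*k≡y*k : ∀ x y k → x * 0ℤ + y * k ≡ y * k
  x*0+y*k≡y*k = solve-∀

-- _<F_ asks for positivity of ((x + y√2)d − (a + b√2)e)·de = (X + Y√2)·k.
<F-if-√2-part-dominates : ∀ a b d x y e →
  let X = x * d - a * e ; Y = y * d - b * e ; k = d * e in
  0ℤ < Y * k → X * k * (X * k) < + 2 * (Y * k * (Y * k)) →
  (mk√2 a b // d) <F (mk√2 x y // e)
<F-if-√2-part-dominates a b d x y e Yk>0 [Xk]²<2[Yk]² =
  subst Pos (sym difference≡) (inj₂ (inj₁ (Yk>0 , [Xk]²<2[Yk]²)))
  where
  open ≡-Reasoning
  difference≡ : ((mk√2 x y ⊗ embed d) ⊕ (⊝ (mk√2 a b ⊗ embed e))) ⊗ embed (d * e)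
              ≡ mk√2 ((x * d - a * e) * (d * e)) ((y * d - b * e) * (d * e))
  difference≡ = begin
    ((mk√2 x y ⊗ embed d) ⊕ (⊝ (mk√2 a b ⊗ embed e))) ⊗ embed (d * e)
      ≡⟨ cong₂ (λ β α → (β ⊕ (⊝ α)) ⊗ embed (d * e)) (⊗-embed x y d) (⊗-embed a b e) ⟩
    mk√2 (x * d - a * e) (y * d - b * e) ⊗ embed (d * e)
      ≡⟨ ⊗-embed (x * d - a * e) (y * d - b * e) (d * e) ⟩
    mk√2 ((x * d - a * e) * (d * e)) ((y * d - b * e) * (d * e))
      ∎

p²+q²<6pq⇒q≢0 : ∀ p q → p * p + q * q < + 6 * (p * q) → ¬ q ≡ 0ℤ
p²+q²<6pq⇒q≢0 p q p²+q²<6pq refl = <⇒≱ p²+q²<6pq (begin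
  + 6 * (p * 0ℤ)  ≡⟨ cong (+ 6 *_) (*-zeroʳ p) ⟩
  0ℤ              ≤⟨ i*i≥0 p ⟩
  p * p           ≡⟨ +-identityʳ (p * p) ⟨
  p * p + 0ℤ      ∎)
  where open ≤-Reasoning

p²+q²<6pq-sym : ∀ p q → p * p + q * q < + 6 * (p * q) → q * q + p * p < + 6 * (q * p)
p²+q²<6pq-sym p q = subst₂ _<_ (+-comm (p * p) (q * q)) (cong (+ 6 *_) (*-comm p q))

between-roots : ∀ p q → p * p + q * q < + 6 * (p * q) →
                (3-2√2 // + 1) <F (embed p // q) × (embed p // q) <F (3+2√2 // + 1)
between-roots p q p²+q²<6pq =
    <F-if-√2-part-dominates (+ 3) (- + 2) (+ 1) p 0ℤ q
      (0<-≡ 2q²>0 (solve (p ∷ q ∷ [])))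
      (0<j-i⇒i<j (0<-≡ q²δ>0 (solve (p ∷ q ∷ []))))
  , <F-if-√2-part-dominates p 0ℤ q (+ 3) (+ 2) (+ 1)
      (0<-≡ 2q²>0 (solve (p ∷ q ∷ [])))
      (0<j-i⇒i<j (0<-≡ q²δ>0 (solve (p ∷ q ∷ []))))
  where
  q²>0 : 0ℤ < q * q
  q²>0 = i≢0⇒i*i>0 (p²+q²<6pq⇒q≢0 p q p²+q²<6pq)
  2q²>0 : 0ℤ < + 2 * (q * q)
  2q²>0 = *-pos (positive⁻¹ (+ 2)) q²>0
  q²δ>0 : 0ℤ < q * q * (+ 6 * (p * q) - (p * p + q * q))
  q²δ>0 = *-pos q²>0 (i<j⇒0<j-i p²+q²<6pq)

module _ (p v : ℤ) (bracket : p * p + + 4 * v * (+ 4 * v) < + 6 * (p * (+ 4 * v))) where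

  private
    δ>0 : 0ℤ < + 6 * (p * (+ 4 * v)) - (p * p + + 4 * v * (+ 4 * v))
    δ>0 = i<j⇒0<j-i bracket
    p²>0 : 0ℤ < p * p
    p²>0 = i≢0⇒i*i>0 (p²+q²<6pq⇒q≢0 (+ 4 * v) p (p²+q²<6pq-sym p (+ 4 * v) bracket))
    v²>0 : 0ℤ < v * v
    v²>0 = i≢0⇒i*i>0 λ v≡0 →
      p²+q²<6pq⇒q≢0 p (+ 4 * v) bracket (trans (cong (+ 4 *_) v≡0) (*-zeroʳ (+ 4)))
    v⁴>0 : 0ℤ < v * v * (v * v)
    v⁴>0 = *-pos v²>0 v²>0

  1/pv<[3+2√2]/4v² : (embed (+ 1) // p * v) <F (3+2√2 // + 4 * (v * v))
  1/pv<[3+2√2]/4v² =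
    <F-if-√2-part-dominates (+ 1) 0ℤ (p * v) (+ 3) (+ 2) (+ 4 * (v * v))
      (0<-≡ (*-pos (positive⁻¹ (+ 8)) (*-pos p²>0 v⁴>0)) (solve (p ∷ v ∷ [])))
      (0<j-i⇒i<j (0<-≡ (*-pos (*-pos (positive⁻¹ (+ 16)) (*-pos p²>0 (*-pos v⁴>0 v⁴>0))) δ>0)
                        (solve (p ∷ v ∷ []))))

  4[3-2√2]v²<pv : (embed (+ 4) ⊗ 3-2√2 ⊗ embed (v * v) // + 1) <F (embed (p * v) // + 1)
  4[3-2√2]v²<pv =
    subst (λ α → (α // + 1) <F (embed (p * v) // + 1)) (sym (⊗-embed (+ 12) (- + 8) (v * v)))
      (<F-if-√2-part-dominates (+ 12 * (v * v)) (- + 8 * (v * v)) (+ 1) (p * v) 0ℤ (+ 1)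
        (0<-≡ (*-pos (positive⁻¹ (+ 8)) v²>0) (solve (p ∷ v ∷ [])))
        (0<j-i⇒i<j (0<-≡ (*-pos v²>0 δ>0) (solve (p ∷ v ∷ [])))))

bracket-from-difference : ∀ p v a → + 4 * v - p ≡ + 4 * a → a * a < p * v →
                          p * p + + 4 * v * (+ 4 * v) < + 6 * (p * (+ 4 * v))
bracket-from-difference p v a 4v-p≡4a a²<pv =
  0<j-i⇒i<j (0<-≡ (*-pos (positive⁻¹ (+ 16)) (i<j⇒0<j-i a²<pv)) (begin
    + 16 * (p * v - a * a)                                   ≡⟨ solve (p ∷ v ∷ a ∷ []) ⟩
    + 4 * (p * (+ 4 * v)) - + 4 * a * (+ 4 * a)              ≡⟨ cong (λ t → + 4 * (p * (+ 4 * v)) - t * t) 4v-p≡4a ⟨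
    + 4 * (p * (+ 4 * v)) - (+ 4 * v - p) * (+ 4 * v - p)    ≡⟨ solve (p ∷ v ∷ []) ⟩
    + 6 * (p * (+ 4 * v)) - (p * p + + 4 * v * (+ 4 * v))    ∎))
  where open ≡-Reasoning

-- The hypotheses 2 ∣ c, 2 ∣ u and Coprime u v only serve to produce u and v;
-- the bounds hold without them.
lemma4p5 : (c : ℤ) → (n : ℕ) → (u v : ℤ) →
    + 2 ∣ c → + 4 ≤ c → 2 ℕ.≤ n →
    let N = 2 ℕ.^ (n ∸ 1) ∸ 1 in
    Coprime u v → + 2 ∣ u → c ≡ u * v →
    + 4 * v ^ N - u ^ N ≡ + 4 * a (n ∸ 1) c →
    ((3-2√2 // + 1) <F (embed (u ^ N) // + 4 * v ^ N)
      × (embed (u ^ N) // + 4 * v ^ N) <F (3+2√2 // + 1))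
    × ((3-2√2 // + 1) <F (embed (+ 4 * v ^ N) // u ^ N)
      × (embed (+ 4 * v ^ N) // u ^ N) <F (3+2√2 // + 1))
    × (embed (+ 1) // (u * v) ^ N) <F (3+2√2 // + 4 * v ^ (2 ℕ.* N))
    × (embed (+ 4) ⊗ 3-2√2 ⊗ embed (v ^ (2 ℕ.* N)) // + 1) <F (embed (c ^ N) // + 1)
lemma4p5 c zero          u v _ _   ()              _ _ _    _
lemma4p5 c (suc zero)    u v _ _   (ℕ.s≤s ())      _ _ _    _
lemma4p5 c (suc (suc m)) u v _ c≥4 _               _ _ c≡uv 4vᴺ-uᴺ≡4a =
    between-roots (u ^ N) (+ 4 * v ^ N) bracket
  , between-roots (+ 4 * v ^ N) (u ^ N) (p²+q²<6pq-sym (u ^ N) (+ 4 * v ^ N) bracket)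
  , subst₂ (λ w x → (embed (+ 1) // w) <F (3+2√2 // + 4 * x))
      (sym (^-distribʳ-* u v N)) (sym v^[2N]≡vᴺvᴺ) (1/pv<[3+2√2]/4v² (u ^ N) (v ^ N) bracket)
  , subst₂ (λ x w → (embed (+ 4) ⊗ 3-2√2 ⊗ embed x // + 1) <F (embed w // + 1))
      (sym v^[2N]≡vᴺvᴺ) (sym cᴺ≡uᴺvᴺ) (4[3-2√2]v²<pv (u ^ N) (v ^ N) bracket)
  where
  N : ℕ
  N = 2 ℕ.^ suc m ∸ 1
  cᴺ≡uᴺvᴺ : c ^ N ≡ u ^ N * v ^ N
  cᴺ≡uᴺvᴺ = trans (cong (_^ N) c≡uv) (^-distribʳ-* u v N)
  v^[2N]≡vᴺvᴺ : v ^ (2 ℕ.* N) ≡ v ^ N * v ^ N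
  v^[2N]≡vᴺvᴺ = trans (cong (λ e → v ^ (N ℕ.+ e)) (ℕ.+-identityʳ N)) (^-distribˡ-+-* v N N)
  bracket : u ^ N * u ^ N + + 4 * v ^ N * (+ 4 * v ^ N) < + 6 * (u ^ N * (+ 4 * v ^ N))
  bracket = bracket-from-difference (u ^ N) (v ^ N) (a (suc m) c) 4vᴺ-uᴺ≡4a
              (subst (a (suc m) c * a (suc m) c <_) cᴺ≡uᴺvᴺ (a[1+k]²<c^[2^[1+k]∸1] c≥4 m))
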